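{- Every satisfiable HyperLTL sentence has a countable model (i.e., is satisfied by some countable set of traces).
   Context: Fix a finite set $AP$ of atomic propositions. A trace over $AP$ is a map $t:\mathbb{N}\to 2^{AP}$. HyperLTL formulas are given by the grammar $\varphi ::= \exists \pi.\ \varphi \mid \forall \pi.\ \varphi \mid \psi$ and $\psi ::= a_\pi \mid \neg\psi \mid \psi\vee\psi \mid \mathbf{X}\psi \mid \psi\,\mathbf{U}\,\psi$, where $a\in AP$ and $\pi$ ranges over a countable set of trace variables. For a set $T$ of traces and a trace assignment $\Pi$ (a partial map from trace variables to traces), with $\Pi[j]$ denoting the assignment mapping each $\pi$ in the domain of $\Pi$ to the suffix $\Pi(\pi)(j)\Pi(\pi)(j+1)\cdots$: $(T,\Pi)\models a_\pi$ iff $a\in\Pi(\pi)(0)$; negation and disjunction are as usual; $(T,\Pi)\models\mathbf{X}\psi$ iff $(T,\Pi[1])\models\psi$; $(T,\Pi)\models\psi_1\mathbf{U}\psi_2$ iff there is $j\ge 0$ with $(T,\Pi[j])\models\psi_2$ and $(T,\Pi[j'])\models\psi_1$ for all $0\le j'<j$; $(T,\Pi)\models\exists\pi.\varphi$ iff there is $t\in T$ with $(T,\Pi[\pi\mapsto t])\models\varphi$; $(T,\Pi)\models\forall\pi.\varphi$ iff this holds for all $t\in T$. A sentence is a formula without free trace variables; $T$ satisfies (is a model of) a sentence $\varphi$ if $(T,\Pi_\emptyset)\models\varphi$ for the empty assignment $\Pi_\emptyset$. A sentence is satisfiable if it has a model. -}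

module Defs where

open import Data.Nat using (ℕ; _+_; _<_; _≡ᵇ_)
open import Data.Fin using (Fin)
open import Data.Bool using (Bool; true; if_then_else_)
open import Data.Maybe using (Maybe; just; nothing)
open import Data.Product using (Σ; _×_; ∃)
open import Data.Sum using (_⊎_)
open import Data.List using (List; []; _∷_)
open import Data.List.Membership.Propositional using (_∈_)
open import Relation.Nullary using (¬_)
open import Relation.Binary.PropositionalEquality using (_≡_)

-- Atomic propositions: the finite set AP = Fin n.
-- A letter (element of 2^AP) is a characteristic function AP → Bool.
Letter : ℕ → Set
Letter n = Fin n → Bool

Trace : ℕ → Set
Trace n = ℕ → Letter n

TraceSet : ℕ → Set₁
TraceSet n = Trace n → Set

Var : Set
Var = ℕ

data Body (n : ℕ) : Set where
  atom  : Fin n → Var → Body n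
  neg   : Body n → Body n
  _∨′_  : Body n → Body n → Body n
  X     : Body n → Body n
  _U_   : Body n → Body n → Body n

data Formula (n : ℕ) : Set where
  ex   : Var → Formula n → Formula n
  all  : Var → Formula n → Formula n
  body : Body n → Formula n

Assignment : ℕ → Set
Assignment n = Var → Maybe (Trace n)

emptyAssignment : ∀ {n} → Assignment n
emptyAssignment _ = nothing

update : ∀ {n} → Assignment n → Var → Trace n → Assignment n
update Π π t π′ = if π′ ≡ᵇ π then just t else Π π′

suffix : ∀ {n} → ℕ → Trace n → Trace n
suffix j t k = t (j + k)

shift : ∀ {n} → ℕ → Assignment n → Assignment n
shift j Π π = Data.Maybe.map (suffix j) (Π π)

atomHolds : ∀ {n} → Fin n → Maybe (Trace n) → Set
atomHolds a (just t) = t 0 a ≡ true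
atomHolds a nothing  = Data.Empty.⊥
  where import Data.Empty

_⊨b_ : ∀ {n} → Assignment n → Body n → Set
Π ⊨b atom a π = atomHolds a (Π π)
Π ⊨b neg ψ = ¬ (Π ⊨b ψ)
Π ⊨b (ψ₁ ∨′ ψ₂) = (Π ⊨b ψ₁) ⊎ (Π ⊨b ψ₂)
Π ⊨b X ψ = shift 1 Π ⊨b ψ
Π ⊨b (ψ₁ U ψ₂) =
  Σ ℕ λ j → (shift j Π ⊨b ψ₂) × (∀ j′ → j′ < j → shift j′ Π ⊨b ψ₁)

Sat : ∀ {n} → TraceSet n → Assignment n → Formula n → Set
Sat T Π (ex π φ)  = Σ (Trace _) λ t → T t × Sat T (update Π π t) φ
Sat T Π (all π φ) = ∀ t → T t → Sat T (update Π π t) φ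
Sat T Π (body ψ)  = Π ⊨b ψ

ScopedB : ∀ {n} → List Var → Body n → Set
ScopedB V (atom a π) = π ∈ V
ScopedB V (neg ψ) = ScopedB V ψ
ScopedB V (ψ₁ ∨′ ψ₂) = ScopedB V ψ₁ × ScopedB V ψ₂
ScopedB V (X ψ) = ScopedB V ψ
ScopedB V (ψ₁ U ψ₂) = ScopedB V ψ₁ × ScopedB V ψ₂

Scoped : ∀ {n} → List Var → Formula n → Set
Scoped V (ex π φ) = Scoped (π ∷ V) φ
Scoped V (all π φ) = Scoped (π ∷ V) φ
Scoped V (body ψ) = ScopedB V ψ

Sentence : ∀ {n} → Formula n → Set
Sentence φ = Scoped [] φ

Model : ∀ {n} → TraceSet n → Formula n → Set
Model T φ = Sat T emptyAssignment φ

Satisfiable : ∀ {n} → Formula n → Set₁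
Satisfiable {n} φ = Σ (TraceSet n) λ T → Model T φ

-- The set of traces enumerated by e : ℕ → Maybe Trace (nothing = no trace);
-- every countable set of traces (including finite and empty ones) is of this form.
Enumerated : ∀ {n} → (ℕ → Maybe (Trace n)) → TraceSet n
Enumerated e t = ∃ λ k → e k ≡ just t

HasCountableModel : ∀ {n} → Formula n → Set
HasCountableModel {n} φ = Σ (ℕ → Maybe (Trace n)) λ e → Model (Enumerated e) φ

-- A downward Löwenheim–Skolem argument. A proof that T satisfies φ is itself a
-- Skolem function: it picks a witness in T for each existential quantifier, given
-- traces for the universal quantifiers in front of it. Starting from the empty set
-- and repeatedly adding all witnesses demanded by universal choices from the current
-- set yields a countable union of countable sets that is closed under the Skolem
-- function. Since the quantifier-free body does not depend on the model, φ then
-- holds in this closure.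
module Submission where

open import Data.Nat using (ℕ; zero; suc; _+_; _≤_; _⊔_; _≤′_; ≤′-refl; ≤′-step)
open import Data.Nat.Properties using (+-suc; +-identityʳ; ≤-refl; ≤-trans; m≤m⊔n; m≤n⊔m; ≤⇒≤′)
open import Data.Product using (Σ; _×_; _,_; proj₁; proj₂; ∃)
open import Data.Maybe using (Maybe; just; nothing; maybe′)
import Data.Maybe as Maybe
open import Relation.Binary.PropositionalEquality using (_≡_; refl; sym; cong; subst)
open import Function using (_∘_)
open import Defs

-- unpair enumerates ℕ × ℕ along the anti-diagonals.
next : ℕ × ℕ → ℕ × ℕ
next (zero  , b) = suc b , zero
next (suc a , b) = a , suc b

unpair : ℕ → ℕ × ℕ
unpair zero    = zero , zero
unpair (suc k) = next (unpair k)

Reached : ℕ × ℕ → Set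
Reached p = ∃ λ k → unpair k ≡ p

reached-next : ∀ {p} → Reached p → Reached (next p)
reached-next (k , eq) = suc k , cong next eq

reached-along-diagonal : ∀ a b → Reached (a + b , zero) → Reached (a , b)
reached-along-diagonal a zero    r = subst (λ c → Reached (c , zero)) (+-identityʳ a) r
reached-along-diagonal a (suc b) r =
  reached-next (reached-along-diagonal (suc a) b (subst (λ c → Reached (c , zero)) (+-suc a b) r))

reached-diagonal-start : ∀ s → Reached (s , zero)
reached-diagonal-start zero    = zero , refl
reached-diagonal-start (suc s) = reached-next (reached-along-diagonal zero s (reached-diagonal-start s))

unpair-surjective : ∀ a b → Reached (a , b)
unpair-surjective a b = reached-along-diagonal a b (reached-diagonal-start (a + b))

Enum : Set → Set
Enum A = ℕ → Maybe A

module _ {A : Set} where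

  infix 4 _∈ₑ_ _⊆ₑ_

  _∈ₑ_ : A → Enum A → Set
  x ∈ₑ S = ∃ λ k → S k ≡ just x

  _⊆ₑ_ : Enum A → Enum A → Set
  S ⊆ₑ R = ∀ {x} → x ∈ₑ S → x ∈ₑ R

  ∅ₑ : Enum A
  ∅ₑ _ = nothing

  ｛_｝ₑ : A → Enum A
  ｛ x ｝ₑ _ = just x

  ∈-｛｝ : ∀ x → x ∈ₑ ｛ x ｝ₑ
  ∈-｛｝ x = zero , refl

  ⋃ : (ℕ → Enum A) → Enum A
  ⋃ F k = F (proj₁ (unpair k)) (proj₂ (unpair k))

  ∈-⋃⁺ : ∀ F i {x} → x ∈ₑ F i → x ∈ₑ ⋃ F
  ∈-⋃⁺ F i {x} (m , eq) with unpair-surjective i m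
  ... | k , u = k , subst (λ p → F (proj₁ p) (proj₂ p) ≡ just x) (sym u) eq

  ∈-⋃⁻ : ∀ F {x} → x ∈ₑ ⋃ F → ∃ λ i → x ∈ₑ F i
  ∈-⋃⁻ F (k , eq) = proj₁ (unpair k) , proj₂ (unpair k) , eq

  infixl 6 _∪ₑ_

  summand : Enum A → Enum A → ℕ → Enum A
  summand S R zero    = S
  summand S R (suc _) = R

  _∪ₑ_ : Enum A → Enum A → Enum A
  S ∪ₑ R = ⋃ (summand S R)

  ∈-∪ˡ : ∀ S R {x} → x ∈ₑ S → x ∈ₑ S ∪ₑ R
  ∈-∪ˡ S R = ∈-⋃⁺ (summand S R) zero

  ∈-∪ʳ : ∀ S R {x} → x ∈ₑ R → x ∈ₑ S ∪ₑ R
  ∈-∪ʳ S R = ∈-⋃⁺ (summand S R) (suc zero)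

module _ {A B : Set} where

  infixl 1 _>>=ₑ_

  _>>=ₑ_ : Enum A → (A → Enum B) → Enum B
  S >>=ₑ G = ⋃ λ k → maybe′ G ∅ₑ (S k)

  ∈->>= : ∀ S G {x y} → x ∈ₑ S → y ∈ₑ G x → y ∈ₑ (S >>=ₑ G)
  ∈->>= S G {y = y} (k , eq) y∈Gx =
    ∈-⋃⁺ _ k (subst (λ z → y ∈ₑ maybe′ G ∅ₑ z) (sym eq) y∈Gx)

  mapₑ : (A → B) → Enum A → Enum B
  mapₑ g S k = Maybe.map g (S k)

  ∈-map⁺ : ∀ g S {x} → x ∈ₑ S → g x ∈ₑ mapₑ g S
  ∈-map⁺ g S (k , eq) = k , cong (Maybe.map g) eq

  ∈-map⁻ : ∀ g S {y} → y ∈ₑ mapₑ g S → ∃ λ x → x ∈ₑ S × g x ≡ y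
  ∈-map⁻ g S (k , eq) with S k in Sₖ
  ∈-map⁻ g S (k , refl) | just x = x , (k , Sₖ) , refl

module SkolemClosure {n : ℕ} (T : TraceSet n) where

  Member : Set
  Member = Σ (Trace n) T

  witnesses : ∀ φ Π → Sat T Π φ → Enum Member → Enum Member
  witnesses (ex π φ)  Π (t , t∈T , sat) S = ｛ t , t∈T ｝ₑ ∪ₑ witnesses φ (update Π π t) sat S
  witnesses (all π φ) Π sat             S =
    S >>=ₑ λ u → witnesses φ (update Π π (proj₁ u)) (sat (proj₁ u) (proj₂ u)) S
  witnesses (body ψ)  Π sat             S = ∅ₑ

  module _ (φ : Formula n) (sat : Model T φ) where

    stage : ℕ → Enum Member
    stage zero    = ∅ₑ
    stage (suc i) = stage i ∪ₑ witnesses φ emptyAssignment sat (stage i)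

    closure : Enum Member
    closure = ⋃ stage

    countableModel : ℕ → Maybe (Trace n)
    countableModel = mapₑ proj₁ closure

    stage-mono′ : ∀ {i j} → i ≤′ j → stage i ⊆ₑ stage j
    stage-mono′ ≤′-refl        x∈ = x∈
    stage-mono′ (≤′-step i≤′j) x∈ = ∈-∪ˡ _ _ (stage-mono′ i≤′j x∈)

    stage-mono : ∀ {i j} → i ≤ j → stage i ⊆ₑ stage j
    stage-mono i≤j = stage-mono′ (≤⇒≤′ i≤j)

    WitnessesEventuallyIn : ∀ ψ Π → Sat T Π ψ → ℕ → Set
    WitnessesEventuallyIn ψ Π sat′ i₀ = ∀ j → i₀ ≤ j → witnesses ψ Π sat′ (stage j) ⊆ₑ closure

    -- At a universal quantifier, i₀ is raised to a stage that already contains the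
    -- trace chosen for the variable.
    satisfied-in-closure : ∀ ψ Π (sat′ : Sat T Π ψ) i₀ →
      WitnessesEventuallyIn ψ Π sat′ i₀ → Sat (Enumerated countableModel) Π ψ
    satisfied-in-closure (ex π ψ) Π (t , t∈T , sat′) i₀ covered =
      t , ∈-map⁺ proj₁ closure (covered i₀ ≤-refl (∈-∪ˡ _ _ (∈-｛｝ (t , t∈T)))) ,
      satisfied-in-closure ψ (update Π π t) sat′ i₀ (λ j i₀≤j → covered j i₀≤j ∘ ∈-∪ʳ _ _)
    satisfied-in-closure (all π ψ) Π sat′ i₀ covered t t∈model
      with ∈-map⁻ proj₁ closure t∈model
    ... | (.t , t∈T) , u∈closure , refl with ∈-⋃⁻ stage u∈closure
    ... | i , u∈stage =
      satisfied-in-closure ψ (update Π π t) (sat′ t t∈T) (i₀ ⊔ i) λ j i₀⊔i≤j →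
        covered j (≤-trans (m≤m⊔n i₀ i) i₀⊔i≤j) ∘
        ∈->>= (stage j) _ (stage-mono (≤-trans (m≤n⊔m i₀ i) i₀⊔i≤j) u∈stage)
    satisfied-in-closure (body ψ) Π sat′ i₀ covered = sat′

    witnesses-in-closure : WitnessesEventuallyIn φ emptyAssignment sat 0
    witnesses-in-closure j _ = ∈-⋃⁺ stage (suc j) ∘ ∈-∪ʳ _ _

open SkolemClosure

theorem2 : (n : ℕ) (φ : Formula n) → Sentence φ → Satisfiable φ → HasCountableModel φ
theorem2 n φ _ (T , sat) =
  countableModel T φ sat ,
  satisfied-in-closure T φ sat φ emptyAssignment sat 0 (witnesses-in-closure T φ sat)
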